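{- Let $(\Gamma,M)$ be an E-GCM graph on $n\ge3$ nodes whose underlying graph $\Gamma$ is a loop, and suppose that for every edge $\{\gamma_i,\gamma_j\}$ the amplitude product $M_{ij}M_{ji}$ equals $1$. Then $(\Gamma,M)$ is not admissible.
   Context: An E-GCM is a real $n\times n$ matrix $M=(M_{ij})$ with $M_{ii}=2$, $M_{ij}\le 0$ for $i\ne j$, $M_{ij}\neq 0$ iff $M_{ji}\ne 0$, and whenever $M_{ij}M_{ji}\neq 0$ either $M_{ij}M_{ji}\ge 4$ or $M_{ij}M_{ji}=4\cos^2(\pi/k)$ for some integer $k\ge 3$. The E-GCM graph $(\Gamma,M)$ has nodes $\gamma_1,\dots,\gamma_n$, with an edge between $\gamma_i,\gamma_j$ ($i\neq j$) iff $M_{ij}\ne0$; the entries $M_{ij}$ are called amplitudes. $\Gamma$ is a loop if its nodes can be numbered $\gamma_1,\dots,\gamma_n$ so that each $\gamma_i$ is adjacent precisely to $\gamma_{i-1}$ and $\gamma_{i+1}$ (indices mod $n$). A position is $\lambda\in\mathbb{R}^n$; dominant if all $\lambda_i\ge0$, nonzero if some $\lambda_i\ne0$. Firing node $\gamma_i$ is allowed only if $\lambda_i>0$ and replaces each $\lambda_j$ by $\lambda_j-M_{ij}\lambda_i$. A game sequence for $\lambda$ is the sequence of nodes fired when repeatedly firing nodes with positive numbers, starting from $\lambda$, until none remain; it converges if it is finite. A connected E-GCM graph is admissible if some nonzero dominant position has a convergent game sequence. -}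

module Defs where

open import Level using (0ℓ)
open import Data.Nat as ℕ using (ℕ; suc; _%_; _≥_)
open import Data.Fin using (Fin; toℕ)
open import Data.List using (List; []; _∷_)
open import Data.Product using (Σ; ∃; _×_; _,_)
open import Data.Sum using (_⊎_)
open import Relation.Binary.PropositionalEquality using (_≡_; _≢_)
open import Relation.Binary.Structures using (IsStrictTotalOrder)
open import Relation.Nullary using (¬_)
open import Function.Definitions using (Injective)
open import Algebra.Structures using (IsCommutativeRing)

-- An ordered field (with propositional equality on the carrier).
-- The real numbers are an instance; the theorem is stated for every
-- ordered field.
record OrderedField : Set₁ where
  infixl 6 _+_ _-_
  infixl 7 _*_
  infix 4 _<_ _≤_
  field
    Carrier : Set
    _+_ _*_ : Carrier → Carrier → Carrier
    -_      : Carrier → Carrier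
    0# 1#   : Carrier
    _<_     : Carrier → Carrier → Set
    isCommutativeRing : IsCommutativeRing _≡_ _+_ _*_ -_ 0# 1#
    isStrictTotalOrder : IsStrictTotalOrder _≡_ _<_
    +-mono-< : ∀ {x y} z → x < y → x + z < y + z
    *-pos    : ∀ {x y} → 0# < x → 0# < y → 0# < x * y
    inverse  : ∀ x → x ≢ 0# → Σ Carrier (λ y → x * y ≡ 1#)
    0≢1      : 0# ≢ 1#

  _-_ : Carrier → Carrier → Carrier
  x - y = x + (- y)

  _≤_ : Carrier → Carrier → Set
  x ≤ y = x < y ⊎ x ≡ y

  2# : Carrier
  2# = 1# + 1#

module _ (F : OrderedField) where
  open OrderedField F

  Matrix : ℕ → Set
  Matrix n = Fin n → Fin n → Carrier

  Position : ℕ → Set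
  Position n = Fin n → Carrier

  record IsEGCMBase {n : ℕ} (M : Matrix n) : Set where
    field
      diag    : ∀ i → M i i ≡ 2#
      offdiag : ∀ i j → i ≢ j → M i j ≤ 0#
      sym0    : ∀ i j → M i j ≢ 0# → M j i ≢ 0#

  Edge : {n : ℕ} → Matrix n → Fin n → Fin n → Set
  Edge M i j = i ≢ j × M i j ≢ 0#

  CycAdj : (n : ℕ) → Fin n → Fin n → Set
  CycSucc : (n : ℕ) → Fin n → Fin n → Set
  CycSucc n a b = (suc (toℕ a) ≡ toℕ b) ⊎ (suc (toℕ a) ≡ n × toℕ b ≡ 0)

  CycAdj n a b = CycSucc n a b ⊎ CycSucc n b a

  -- Γ is a loop: nodes can be renumbered (σ injective on Fin n, hence a
  -- bijection) so that γ_σa and γ_σb are adjacent iff b = a ± 1 mod n.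
  IsLoop : {n : ℕ} → Matrix n → Set
  IsLoop {n} M = Σ (Fin n → Fin n) λ σ → Injective _≡_ _≡_ σ ×
    (∀ a b → a ≢ b → (Edge M (σ a) (σ b) → CycAdj n a b)
                   × (CycAdj n a b → Edge M (σ a) (σ b)))

  fire : {n : ℕ} → Matrix n → Fin n → Position n → Position n
  fire M i λ' j = λ' j - M i j * λ' i

  data Play {n : ℕ} (M : Matrix n) : Position n → List (Fin n) → Position n → Set where
    done : ∀ {λ'} → Play M λ' [] λ'
    step : ∀ {λ' μ is} i → 0# < λ' i → Play M (fire M i λ') is μ → Play M λ' (i ∷ is) μ

  Terminal : {n : ℕ} → Position n → Set
  Terminal λ' = ∀ i → ¬ (0# < λ' i)

  -- the game sequence from λ' converges: some (equivalently every) play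
  -- from λ' reaches a position with no positive entry
  Converges : {n : ℕ} → Matrix n → Position n → Set
  Converges M λ' = Σ (List _) λ is → Σ (Position _) λ μ → Play M λ' is μ × Terminal μ

  Dominant : {n : ℕ} → Position n → Set
  Dominant λ' = ∀ i → 0# ≤ λ' i

  Nonzero : {n : ℕ} → Position n → Set
  Nonzero λ' = ∃ λ i → λ' i ≢ 0#

  Admissible : {n : ℕ} → Matrix n → Set
  Admissible M = Σ (Position _) λ λ' → Dominant λ' × Nonzero λ' × Converges M λ'

-- If c has positive entries and M c ≤ 0 componentwise, the potential λ ↦ Σⱼ cⱼ λⱼ never
-- decreases in the game, because firing γᵢ lowers it by λᵢ (M c)ᵢ.  It is positive at a
-- nonzero dominant position and nonpositive at a terminal one, so no such game converges.
--
-- For the loop, number the nodes 0, …, N−1 along it (this preserves admissibility) and put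
-- yⱼ = −M_{j+1,j} > 0 (backward), xⱼ = −M_{j,j+1} = 1/yⱼ (forward), indices mod N,
-- eⱼ = y₀ ⋯ y_{j−1} (gauge), q = e_N and cⱼ = eⱼ (j + q (N − j)) for 0 ≤ j ≤ N (weight),
-- so that c_N = c₀.  As xⱼ e_{j+1} = y_{j−1} e_{j−1} = eⱼ and j + q (N − j) is affine in j,
-- row j of M c vanishes for 0 < j < N, and row 0 equals 2q − 1 − q² ≤ 0.

module Submission where

open import Defs
open import Data.Nat using (ℕ; _≥_)
open import Relation.Binary.PropositionalEquality using (_≡_)
open import Relation.Nullary using (¬_)

import Data.Nat as ℕ
open import Data.Nat using (zero; suc; _∸_; z≤n; s≤s)
import Data.Nat.Properties as ℕₚ
open import Data.Nat.DivMod using (m%n<n; m<n⇒m%n≡m; n%n≡0)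
open import Data.Fin as Fin using (Fin; toℕ; fromℕ<; punchOut)
open import Data.Fin.Properties using (toℕ-fromℕ<; toℕ-injective; toℕ<n; any?; injective⇒≤; punchOut-injective)
open import Data.Bool using (if_then_else_)
open import Data.Empty using (⊥-elim)
open import Data.List using ([]; _∷_)
open import Data.Product using (∃; _,_; proj₁; proj₂)
open import Data.Sum using (inj₁; inj₂; [_,_])
open import Function using (_∘_)
open import Function.Definitions using (Injective)
open import Relation.Nullary using (does; yes; no)
open import Relation.Binary.PropositionalEquality using (refl; sym; trans; cong; cong₂; subst; subst₂; _≢_)
open import Relation.Binary.Bundles using (StrictTotalOrder)
open import Relation.Binary.Definitions using (tri<; tri≈; tri>)
open import Algebra.Bundles using (CommutativeRing)

module OrderedFieldProperties (F : OrderedField) where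
  open OrderedField F

  commutativeRing : CommutativeRing _ _
  commutativeRing = record { isCommutativeRing = isCommutativeRing }

  strictTotalOrder : StrictTotalOrder _ _ _
  strictTotalOrder = record { isStrictTotalOrder = isStrictTotalOrder }

  open CommutativeRing commutativeRing public
    using (ring; semiring; commutativeSemiring; +-comm; +-identityˡ; +-identityʳ;
           *-identityˡ; -‿inverseʳ; -‿inverseˡ; zeroˡ; zeroʳ; distribˡ)
  open import Algebra.Properties.Ring ring public
    using (-‿involutive; -‿distribˡ-*; -‿distribʳ-*; -‿+-comm; x[y-z]≈xy-xz; //-rightDividesˡ)
  open import Algebra.Properties.Semiring.Sum semiring public
    using (sum-cong-≗; sum-replicate-zero; ∑-distrib-+; *-distribˡ-sum; sum-syntax)
  open import Algebra.Properties.Semiring.Mult semiring public using (_×_)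
  open import Algebra.Solver.Ring.NaturalCoefficients.Default commutativeSemiring public
  open StrictTotalOrder strictTotalOrder public using (compare; strictPartialOrder; _≟_)
    renaming (irrefl to <-irrefl; trans to <-trans)
  open import Relation.Binary.Reasoning.StrictPartialOrder strictPartialOrder public

  +-monoʳ-< : ∀ {x y} z → x < y → z + x < z + y
  +-monoʳ-< {x} {y} z x<y = subst₂ _<_ (+-comm x z) (+-comm y z) (+-mono-< z x<y)

  +-monoˡ-≤ : ∀ {x y} z → x ≤ y → x + z ≤ y + z
  +-monoˡ-≤ z (inj₁ x<y) = inj₁ (+-mono-< z x<y)
  +-monoˡ-≤ z (inj₂ refl) = inj₂ refl

  +-monoʳ-≤ : ∀ {x y} z → x ≤ y → z + x ≤ z + y
  +-monoʳ-≤ z (inj₁ x<y) = inj₁ (+-monoʳ-< z x<y)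
  +-monoʳ-≤ z (inj₂ refl) = inj₂ refl

  +-mono-≤ : ∀ {x y u v} → x ≤ y → u ≤ v → x + u ≤ y + v
  +-mono-≤ {x} {y} {u} {v} x≤y u≤v = begin
    x + u ≤⟨ +-monoˡ-≤ u x≤y ⟩
    y + u ≤⟨ +-monoʳ-≤ y u≤v ⟩
    y + v ∎

  +-mono-<-≤ : ∀ {x y u v} → x < y → u ≤ v → x + u < y + v
  +-mono-<-≤ {x} {y} {u} {v} x<y u≤v = begin-strict
    x + u <⟨ +-mono-< u x<y ⟩
    y + u ≤⟨ +-monoʳ-≤ y u≤v ⟩
    y + v ∎

  +-mono-≤-< : ∀ {x y u v} → x ≤ y → u < v → x + u < y + v
  +-mono-≤-< {x} {y} {u} {v} x≤y u<v = begin-strict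
    x + u ≤⟨ +-monoˡ-≤ u x≤y ⟩
    y + u <⟨ +-monoʳ-< y u<v ⟩
    y + v ∎

  x<0⇒0<-x : ∀ {x} → x < 0# → 0# < - x
  x<0⇒0<-x {x} x<0 = subst₂ _<_ (-‿inverseʳ x) (+-identityˡ (- x)) (+-mono-< (- x) x<0)

  0<-x⇒x<0 : ∀ {x} → 0# < - x → x < 0#
  0<-x⇒x<0 {x} 0<-x = subst₂ _<_ (+-identityˡ x) (-‿inverseˡ x) (+-mono-< x 0<-x)

  -x*-y≡x*y : ∀ x y → - x * - y ≡ x * y
  -x*-y≡x*y x y = begin-equality
    - x * - y     ≡⟨ sym (-‿distribˡ-* x (- y)) ⟩
    - (x * - y)   ≡⟨ cong -_ (sym (-‿distribʳ-* x y)) ⟩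
    - - (x * y)   ≡⟨ -‿involutive (x * y) ⟩
    x * y         ∎

  0<1 : 0# < 1#
  0<1 with compare 0# 1#
  ... | tri< 0<1 _ _ = 0<1
  ... | tri≈ _ 0≡1 _ = ⊥-elim (0≢1 0≡1)
  ... | tri> _ _ 1<0 = ⊥-elim (<-irrefl refl (<-trans 1<0 0<1*1))
    where
    0<1*1 : 0# < 1#
    0<1*1 = subst (0# <_) (trans (-x*-y≡x*y 1# 1#) (*-identityˡ 1#))
                  (*-pos (x<0⇒0<-x 1<0) (x<0⇒0<-x 1<0))

  0≤n×1 : ∀ n → 0# ≤ n × 1#
  0<n×1 : ∀ {n} → 0 ℕ.< n → 0# < n × 1#

  0≤n×1 zero = inj₂ refl
  0≤n×1 (suc n) = inj₁ (0<n×1 {suc n} (s≤s z≤n))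

  0<n×1 {suc n} _ = begin-strict
    0#               ≡⟨ sym (+-identityʳ 0#) ⟩
    0# + 0#          <⟨ +-mono-<-≤ 0<1 (0≤n×1 n) ⟩
    1# + n × 1#      ∎

  ≤∧≢⇒< : ∀ {x y} → x ≤ y → x ≢ y → x < y
  ≤∧≢⇒< (inj₁ x<y) _ = x<y
  ≤∧≢⇒< (inj₂ x≡y) x≢y = ⊥-elim (x≢y x≡y)

  ≮⇒≥ : ∀ {x y} → ¬ (x < y) → y ≤ x
  ≮⇒≥ {x} {y} x≮y with compare x y
  ... | tri< x<y _ _ = ⊥-elim (x≮y x<y)
  ... | tri≈ _ refl _ = inj₂ refl
  ... | tri> _ _ y<x = inj₁ y<x

  *-nonneg : ∀ {x y} → 0# ≤ x → 0# ≤ y → 0# ≤ x * y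
  *-nonneg (inj₁ 0<x) (inj₁ 0<y) = inj₁ (*-pos 0<x 0<y)
  *-nonneg {x} (inj₁ _) (inj₂ refl) = inj₂ (sym (zeroʳ x))
  *-nonneg {_} {y} (inj₂ refl) _ = inj₂ (sym (zeroˡ y))

  *-pos-nonpos : ∀ {x y} → 0# < x → y ≤ 0# → x * y ≤ 0#
  *-pos-nonpos {x} {y} 0<x (inj₁ y<0) =
    inj₁ (0<-x⇒x<0 (subst (0# <_) (sym (-‿distribʳ-* x y)) (*-pos 0<x (x<0⇒0<-x y<0))))
  *-pos-nonpos {x} _ (inj₂ refl) = inj₂ (zeroʳ x)

  x*x≥0 : ∀ x → 0# ≤ x * x
  x*x≥0 x with compare 0# x
  ... | tri< 0<x _ _ = inj₁ (*-pos 0<x 0<x)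
  ... | tri≈ _ refl _ = inj₂ (sym (zeroˡ 0#))
  ... | tri> _ _ x<0 = inj₁ (subst (0# <_) (-x*-y≡x*y x x) (*-pos (x<0⇒0<-x x<0) (x<0⇒0<-x x<0)))

  x+x≤1+x*x : ∀ x → x + x ≤ 1# + x * x
  x+x≤1+x*x x = begin
    x + x                                   ≡⟨ sym (+-identityˡ (x + x)) ⟩
    0# + (x + x)                            ≤⟨ +-monoˡ-≤ (x + x) (x*x≥0 (1# - x)) ⟩
    (1# - x) * (1# - x) + (x + x)           ≡⟨ expand (- x) x ⟩
    (1# + - x * - x) + ((- x + x) + (- x + x)) ≡⟨ cong₂ (λ s t → (1# + s) + (t + t)) (-x*-y≡x*y x x) (-‿inverseˡ x) ⟩
    (1# + x * x) + (0# + 0#)                ≡⟨ cong ((1# + x * x) +_) (+-identityˡ 0#) ⟩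
    (1# + x * x) + 0#                       ≡⟨ +-identityʳ _ ⟩
    1# + x * x                              ∎
    where
    expand : ∀ w x → (1# + w) * (1# + w) + (x + x) ≡ (1# + w * w) + ((w + x) + (w + x))
    expand = solve 2 (λ w x → (con 1 :+ w) :* (con 1 :+ w) :+ (x :+ x)
                               := (con 1 :+ w :* w) :+ ((w :+ x) :+ (w :+ x))) refl

  ∑-mono-≤ : ∀ {n} {f g : Fin n → Carrier} → (∀ i → f i ≤ g i) → ∑[ i < n ] f i ≤ ∑[ i < n ] g i
  ∑-mono-≤ {zero} _ = inj₂ refl
  ∑-mono-≤ {suc n} f≤g = +-mono-≤ (f≤g Fin.zero) (∑-mono-≤ (f≤g ∘ Fin.suc))

  ∑-mono-< : ∀ {n} {f g : Fin n → Carrier} → (∀ i → f i ≤ g i) → ∀ t → f t < g t →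
             ∑[ i < n ] f i < ∑[ i < n ] g i
  ∑-mono-< f≤g Fin.zero ft<gt = +-mono-<-≤ ft<gt (∑-mono-≤ (f≤g ∘ Fin.suc))
  ∑-mono-< f≤g (Fin.suc t) ft<gt = +-mono-≤-< (f≤g Fin.zero) (∑-mono-< (f≤g ∘ Fin.suc) t ft<gt)

  single : ∀ {n} → Fin n → Carrier → Fin n → Carrier
  single b x a = if does (a Fin.≟ b) then x else 0#

  ∑-single : ∀ {n} (b : Fin n) x → ∑[ a < n ] single b x a ≡ x
  ∑-single {suc n} Fin.zero x = trans (cong (x +_) (sum-replicate-zero n)) (+-identityʳ x)
  ∑-single {suc n} (Fin.suc b) x = trans (+-identityˡ _) (∑-single b x)

  ∑-support₃ : ∀ {n} (f : Fin n → Carrier) {a b c} → a ≢ b → a ≢ c → b ≢ c →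
               (∀ i → i ≢ a → i ≢ b → i ≢ c → f i ≡ 0#) →
               ∑[ i < n ] f i ≡ f a + (f b + f c)
  ∑-support₃ {n} f {a} {b} {c} a≢b a≢c b≢c outside = begin-equality
    ∑[ i < n ] f i                              ≡⟨ sum-cong-≗ decompose ⟩
    ∑[ i < n ] (δa i + (δb i + δc i))           ≡⟨ ∑-distrib-+ δa _ ⟩
    ∑[ i < n ] δa i + ∑[ i < n ] (δb i + δc i)  ≡⟨ cong (∑[ i < n ] δa i +_) (∑-distrib-+ δb δc) ⟩
    ∑[ i < n ] δa i + (∑[ i < n ] δb i + ∑[ i < n ] δc i)
      ≡⟨ cong₂ _+_ (∑-single a (f a)) (cong₂ _+_ (∑-single b (f b)) (∑-single c (f c))) ⟩
    f a + (f b + f c)                           ∎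
    where
    δa δb δc : Fin n → Carrier
    δa = single a (f a)
    δb = single b (f b)
    δc = single c (f c)
    decompose : ∀ i → f i ≡ δa i + (δb i + δc i)
    decompose i with i Fin.≟ a | i Fin.≟ b | i Fin.≟ c
    ... | yes refl | yes refl | _        = ⊥-elim (a≢b refl)
    ... | yes refl | _        | yes refl = ⊥-elim (a≢c refl)
    ... | _        | yes refl | yes refl = ⊥-elim (b≢c refl)
    ... | yes refl | no _     | no _     = solve 1 (λ x → x := x :+ (con 0 :+ con 0)) refl (f i)
    ... | no _     | yes refl | no _     = solve 1 (λ x → x := con 0 :+ (x :+ con 0)) refl (f i)
    ... | no _     | no _     | yes refl = solve 1 (λ x → x := con 0 :+ (con 0 :+ x)) refl (f i)
    ... | no i≢a   | no i≢b   | no i≢c   =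
      trans (outside i i≢a i≢b i≢c) (solve 0 (con 0 := con 0 :+ (con 0 :+ con 0)) refl)

module Potential (F : OrderedField) where
  open OrderedField F
  open OrderedFieldProperties F

  infixr 7 _*ᵛ_
  _*ᵛ_ : ∀ {n} → Matrix F n → (Fin n → Carrier) → Fin n → Carrier
  (_*ᵛ_ {n} M c) i = ∑[ j < n ] (M i j * c j)

  potential : ∀ {n} → (Fin n → Carrier) → Position F n → Carrier
  potential {n} c λ' = ∑[ j < n ] (c j * λ' j)

  module _ {n} (M : Matrix F n) (c : Fin n → Carrier) where

    potential-fire : ∀ i λ' → potential c (fire F M i λ') + λ' i * (M *ᵛ c) i ≡ potential c λ'
    potential-fire i λ' = begin-equality
      potential c (fire F M i λ') + λ' i * (M *ᵛ c) i
        ≡⟨ cong (potential c (fire F M i λ') +_) (*-distribˡ-sum (λ' i) (λ j → M i j * c j)) ⟩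
      potential c (fire F M i λ') + ∑[ j < n ] (λ' i * (M i j * c j))
        ≡⟨ sym (∑-distrib-+ (λ j → c j * fire F M i λ' j) (λ j → λ' i * (M i j * c j))) ⟩
      ∑[ j < n ] (c j * (λ' j - M i j * λ' i) + λ' i * (M i j * c j))
        ≡⟨ sum-cong-≗ (λ j → cancel (c j) (λ' j) (M i j) (λ' i)) ⟩
      potential c λ' ∎
      where
      cancel : ∀ c l m l′ → c * (l - m * l′) + l′ * (m * c) ≡ c * l
      cancel c l m l′ = begin-equality
        c * (l - m * l′) + l′ * (m * c)
          ≡⟨ cong₂ _+_ (x[y-z]≈xy-xz c l (m * l′))
                       (solve 3 (λ c m l′ → l′ :* (m :* c) := c :* (m :* l′)) refl c m l′) ⟩
        (c * l - c * (m * l′)) + c * (m * l′)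
          ≡⟨ //-rightDividesˡ (c * (m * l′)) (c * l) ⟩
        c * l ∎

    module _ (Mc≤0 : ∀ i → (M *ᵛ c) i ≤ 0#) where

      potential-fire-mono : ∀ {i λ'} → 0# < λ' i → potential c λ' ≤ potential c (fire F M i λ')
      potential-fire-mono {i} {λ'} 0<λ'i = begin
        potential c λ'                   ≡⟨ sym (potential-fire i λ') ⟩
        P + λ' i * (M *ᵛ c) i            ≤⟨ +-monoʳ-≤ P (*-pos-nonpos 0<λ'i (Mc≤0 i)) ⟩
        P + 0#                           ≡⟨ +-identityʳ P ⟩
        P                                ∎
        where P = potential c (fire F M i λ')

      potential-play-mono : ∀ {λ' is μ} → Play F M λ' is μ → potential c λ' ≤ potential c μ
      potential-play-mono done = inj₂ refl
      potential-play-mono {λ'} {_} {μ} (step i 0<λ'i play) = begin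
        potential c λ'               ≤⟨ potential-fire-mono 0<λ'i ⟩
        potential c (fire F M i λ')  ≤⟨ potential-play-mono play ⟩
        potential c μ                ∎

    module _ (c-positive : ∀ j → 0# < c j) where

      potential-positive : ∀ {λ'} → Dominant F λ' → Nonzero F λ' → 0# < potential c λ'
      potential-positive {λ'} dominant (t , λ't≢0) = begin-strict
        0#                      ≡⟨ sym (sum-replicate-zero n) ⟩
        ∑[ j < n ] 0#           <⟨ ∑-mono-< (λ j → *-nonneg (inj₁ (c-positive j)) (dominant j)) t
                                     (*-pos (c-positive t) (≤∧≢⇒< (dominant t) (λ't≢0 ∘ sym))) ⟩
        potential c λ'          ∎

      potential-terminal-nonpos : ∀ {μ} → Terminal F μ → potential c μ ≤ 0#
      potential-terminal-nonpos {μ} terminal = begin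
        potential c μ   ≤⟨ ∑-mono-≤ (λ j → *-pos-nonpos (c-positive j) (≮⇒≥ (terminal j))) ⟩
        ∑[ j < n ] 0#   ≡⟨ sum-replicate-zero n ⟩
        0#              ∎

  positive-Mc≤0⇒¬Admissible : ∀ {n} (M : Matrix F n) (c : Fin n → Carrier) →
    (∀ j → 0# < c j) → (∀ i → (M *ᵛ c) i ≤ 0#) → ¬ Admissible F M
  positive-Mc≤0⇒¬Admissible M c c-positive Mc≤0 (λ' , dominant , nonzero , _ , μ , play , terminal) =
    <-irrefl refl (begin-strict
      0#               <⟨ potential-positive M c c-positive dominant nonzero ⟩
      potential c λ'   ≤⟨ potential-play-mono M c Mc≤0 play ⟩
      potential c μ    ≤⟨ potential-terminal-nonpos M c c-positive terminal ⟩
      0#               ∎)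

injective⇒surjective : ∀ {n} {σ : Fin n → Fin n} → Injective _≡_ _≡_ σ → ∀ i → ∃ λ a → σ a ≡ i
injective⇒surjective {suc m} {σ} σ-injective i with any? (λ a → σ a Fin.≟ i)
... | yes hit = hit
... | no miss = ⊥-elim (ℕₚ.<-irrefl refl (injective⇒≤ σ∖i-injective))
  where
  i≢σ : ∀ a → i ≢ σ a
  i≢σ a i≡σa = miss (a , sym i≡σa)
  σ∖i : Fin (suc m) → Fin m
  σ∖i a = punchOut (i≢σ a)
  σ∖i-injective : Injective _≡_ _≡_ σ∖i
  σ∖i-injective {a} {b} = σ-injective ∘ punchOut-injective (i≢σ a) (i≢σ b)

module Relabelling (F : OrderedField) where

  relabel : ∀ {n} → (Fin n → Fin n) → Matrix F n → Matrix F n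
  relabel σ M a b = M (σ a) (σ b)

  module _ {n} {M : Matrix F n} {σ : Fin n → Fin n} (σ-injective : Injective _≡_ _≡_ σ) where

    play-relabel : ∀ {λ' is μ} → Play F M λ' is μ → ∃ λ js → Play F (relabel σ M) (λ' ∘ σ) js (μ ∘ σ)
    play-relabel done = [] , done
    play-relabel (step i 0<λ'i play) with injective⇒surjective σ-injective i | play-relabel play
    ... | a , refl | js , play′ = a ∷ js , step a 0<λ'i play′

    admissible-relabel : Admissible F M → Admissible F (relabel σ M)
    admissible-relabel (λ' , dominant , (t , λ't≢0) , _ , μ , play , terminal)
      with injective⇒surjective σ-injective t | play-relabel play
    ... | a , refl | js , play′ = λ' ∘ σ , dominant ∘ σ , (a , λ't≢0) , js , μ ∘ σ , play′ , terminal ∘ σ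

module Cycle (F : OrderedField) (k : ℕ) where

  L N : ℕ
  L = 2 ℕ.+ k
  N = suc L

  N∸i≡1+N∸1+i : ∀ {i} → i ℕ.< N → N ∸ i ≡ suc (N ∸ suc i)
  N∸i≡1+N∸1+i i<N = ℕₚ.+-∸-assoc 1 (ℕ.s≤s⁻¹ i<N)

  node : ℕ → Fin N
  node j = fromℕ< (m%n<n j N)

  toℕ-node : ∀ {j} → j ℕ.< N → toℕ (node j) ≡ j
  toℕ-node j<N = trans (toℕ-fromℕ< _) (m<n⇒m%n≡m j<N)

  toℕ-node-N : toℕ (node N) ≡ 0
  toℕ-node-N = trans (toℕ-fromℕ< _) (n%n≡0 N)

  node-toℕ : ∀ a → node (toℕ a) ≡ a
  node-toℕ a = toℕ-injective (toℕ-node (toℕ<n a))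

  node-N : node N ≡ node 0
  node-N = toℕ-injective toℕ-node-N

  node-succ : ∀ {j} → j ℕ.< N → CycSucc F N (node j) (node (suc j))
  node-succ {j} j<N with ℕₚ.m≤n⇒m<n∨m≡n j<N
  ... | inj₁ 1+j<N = inj₁ (trans (cong suc (toℕ-node j<N)) (sym (toℕ-node 1+j<N)))
  ... | inj₂ 1+j≡N = inj₂ (trans (cong suc (toℕ-node j<N)) 1+j≡N , trans (cong (toℕ ∘ node) 1+j≡N) toℕ-node-N)

  CycSucc-irrefl : ∀ {a b} → CycSucc F N a b → a ≢ b
  CycSucc-irrefl (inj₁ 1+a≡a) refl = ℕₚ.1+n≢n 1+a≡a
  CycSucc-irrefl (inj₂ (1+a≡N , a≡0)) refl with trans (cong suc (sym a≡0)) 1+a≡N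
  ... | ()

  CycAdj-irrefl : ∀ {a b} → CycAdj F N a b → a ≢ b
  CycAdj-irrefl = [ CycSucc-irrefl , (λ b↦a → CycSucc-irrefl b↦a ∘ sym) ]

  CycSucc-asym : ∀ {a b} → CycSucc F N a b → ¬ CycSucc F N b a
  CycSucc-asym (inj₁ 1+a≡b) (inj₁ 1+b≡a) = ℕₚ.m≢1+n+m _ {1} (sym (trans (cong suc 1+a≡b) 1+b≡a))
  CycSucc-asym (inj₁ 1+a≡b) (inj₂ (1+b≡N , a≡0)) with trans (cong (suc ∘ suc) (sym a≡0)) (trans (cong suc 1+a≡b) 1+b≡N)
  ... | ()
  CycSucc-asym (inj₂ (1+a≡N , b≡0)) (inj₁ 1+b≡a) with trans (cong (suc ∘ suc) (sym b≡0)) (trans (cong suc 1+b≡a) 1+a≡N)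
  ... | ()
  CycSucc-asym (inj₂ (_ , b≡0)) (inj₂ (1+b≡N , _)) with trans (cong suc (sym b≡0)) 1+b≡N
  ... | ()

  CycSucc-functionalʳ : ∀ {a b b′} → CycSucc F N a b → CycSucc F N a b′ → b ≡ b′
  CycSucc-functionalʳ (inj₁ 1+a≡b) (inj₁ 1+a≡b′) = toℕ-injective (trans (sym 1+a≡b) 1+a≡b′)
  CycSucc-functionalʳ {b = b} (inj₁ 1+a≡b) (inj₂ (1+a≡N , _)) = ⊥-elim (ℕₚ.<-irrefl (trans (sym 1+a≡b) 1+a≡N) (toℕ<n b))
  CycSucc-functionalʳ {b′ = b′} (inj₂ (1+a≡N , _)) (inj₁ 1+a≡b′) = ⊥-elim (ℕₚ.<-irrefl (trans (sym 1+a≡b′) 1+a≡N) (toℕ<n b′))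
  CycSucc-functionalʳ (inj₂ (_ , b≡0)) (inj₂ (_ , b′≡0)) = toℕ-injective (trans b≡0 (sym b′≡0))

  CycSucc-functionalˡ : ∀ {a a′ b} → CycSucc F N a b → CycSucc F N a′ b → a ≡ a′
  CycSucc-functionalˡ (inj₁ 1+a≡b) (inj₁ 1+a′≡b) = toℕ-injective (ℕₚ.suc-injective (trans 1+a≡b (sym 1+a′≡b)))
  CycSucc-functionalˡ (inj₁ 1+a≡b) (inj₂ (_ , b≡0)) with trans 1+a≡b b≡0
  ... | ()
  CycSucc-functionalˡ (inj₂ (_ , b≡0)) (inj₁ 1+a′≡b) with trans 1+a′≡b b≡0
  ... | ()
  CycSucc-functionalˡ (inj₂ (1+a≡N , _)) (inj₂ (1+a′≡N , _)) = toℕ-injective (ℕₚ.suc-injective (trans 1+a≡N (sym 1+a′≡N)))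

module StandardUnitLoop (F : OrderedField) (k : ℕ) where
  open OrderedField F
  open OrderedFieldProperties F
  open Potential F
  open Relabelling F
  open Cycle F k

  record IsStandardUnitLoop (M : Matrix F N) : Set where
    field
      diagonal          : ∀ a → M a a ≡ 2#
      support           : ∀ a b → a ≢ b → M a b ≢ 0# → CycAdj F N a b
      adjacent-negative : ∀ a b → CycAdj F N a b → M a b < 0#
      adjacent-product  : ∀ a b → CycAdj F N a b → M a b * M b a ≡ 1#

  module UnitLoop {M : Matrix F N} (loop : IsStandardUnitLoop M) where
    open IsStandardUnitLoop loop

    *ᵛ-row : ∀ {bp b bn} → CycSucc F N bp b → CycSucc F N b bn → ∀ v →
             (M *ᵛ v) b ≡ M b b * v b + (M b bn * v bn + M b bp * v bp)
    *ᵛ-row {bp} {b} {bn} bp↦b b↦bn v = ∑-support₃ (λ a → M b a * v a) b≢bn b≢bp bn≢bp outside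
      where
      b≢bn : b ≢ bn
      b≢bn = CycSucc-irrefl b↦bn
      b≢bp : b ≢ bp
      b≢bp = CycSucc-irrefl bp↦b ∘ sym
      bn≢bp : bn ≢ bp
      bn≢bp refl = CycSucc-asym b↦bn bp↦b
      outside : ∀ a → a ≢ b → a ≢ bn → a ≢ bp → M b a * v a ≡ 0#
      outside a a≢b a≢bn a≢bp with M b a ≟ 0#
      ... | yes Mba≡0 = trans (cong (_* v a) Mba≡0) (zeroˡ (v a))
      ... | no Mba≢0 with support b a (a≢b ∘ sym) Mba≢0
      ...   | inj₁ b↦a = ⊥-elim (a≢bn (CycSucc-functionalʳ b↦a b↦bn))
      ...   | inj₂ a↦b = ⊥-elim (a≢bp (CycSucc-functionalˡ a↦b bp↦b))

    *ᵛ-row-nonpos : ∀ {bp b bn} → CycSucc F N bp b → CycSucc F N b bn → ∀ v →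
                    v b + v b ≤ - M b bn * v bn + - M b bp * v bp → (M *ᵛ v) b ≤ 0#
    *ᵛ-row-nonpos {bp} {b} {bn} bp↦b b↦bn v ineq = begin
      (M *ᵛ v) b                            ≡⟨ *ᵛ-row bp↦b b↦bn v ⟩
      M b b * v b + s                       ≡⟨ cong (λ d → d * v b + s) (diagonal b) ⟩
      2# * v b + s                          ≡⟨ cong (_+ s) (solve 1 (λ x → (con 1 :+ con 1) :* x := x :+ x) refl (v b)) ⟩
      (v b + v b) + s                       ≤⟨ +-monoˡ-≤ s ineq ⟩
      (- M b bn * v bn + - M b bp * v bp) + s
        ≡⟨ cong (_+ s) (trans (sym (cong₂ _+_ (-‿distribˡ-* _ _) (-‿distribˡ-* _ _))) (-‿+-comm _ _)) ⟩
      - s + s                               ≡⟨ -‿inverseˡ s ⟩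
      0#                                    ∎
      where
      s : Carrier
      s = M b bn * v bn + M b bp * v bp

    forward backward : ℕ → Carrier
    forward j = - M (node j) (node (suc j))
    backward j = - M (node (suc j)) (node j)

    backward-positive : ∀ {j} → j ℕ.< N → 0# < backward j
    backward-positive j<N = x<0⇒0<-x (adjacent-negative _ _ (inj₂ (node-succ j<N)))

    forward*backward≡1 : ∀ {j} → j ℕ.< N → forward j * backward j ≡ 1#
    forward*backward≡1 j<N = trans (-x*-y≡x*y _ _) (adjacent-product _ _ (inj₁ (node-succ j<N)))

    gauge : ℕ → Carrier
    gauge zero = 1#
    gauge (suc j) = gauge j * backward j

    gauge-positive : ∀ {j} → j ℕ.≤ N → 0# < gauge j
    gauge-positive {zero} _ = 0<1
    gauge-positive {suc j} j<N = *-pos (gauge-positive (ℕₚ.<⇒≤ j<N)) (backward-positive j<N)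

    q : Carrier
    q = gauge N

    affine : ℕ → Carrier
    affine j = j × 1# + q * ((N ∸ j) × 1#)

    weight : ℕ → Carrier
    weight j = gauge j * affine j

    c : Fin N → Carrier
    c a = weight (toℕ a)

    affine-positive : ∀ {j} → j ℕ.< N → 0# < affine j
    affine-positive {j} j<N = begin-strict
      0#                          ≡⟨ sym (+-identityʳ 0#) ⟩
      0# + 0#                     <⟨ +-mono-≤-< (0≤n×1 j) (*-pos (gauge-positive ℕₚ.≤-refl) (0<n×1 (ℕₚ.m<n⇒0<n∸m j<N))) ⟩
      affine j                    ∎

    c-positive : ∀ a → 0# < c a
    c-positive a = *-pos (gauge-positive (ℕₚ.<⇒≤ (toℕ<n a))) (affine-positive (toℕ<n a))

    affine-harmonic : ∀ {i} → suc i ℕ.< N → affine (suc (suc i)) + affine i ≡ affine (suc i) + affine (suc i)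
    affine-harmonic {i} 1+i<N = begin-equality
      affine (suc (suc i)) + affine i
        ≡⟨ cong (λ m → affine (suc (suc i)) + (i × 1# + q * (m × 1#))) N∸i ⟩
      (suc (suc i) × 1# + q * (r × 1#)) + (i × 1# + q * (suc (suc r) × 1#))
        ≡⟨ solve 3 (λ x q y → ((con 1 :+ (con 1 :+ x)) :+ q :* y) :+ (x :+ q :* (con 1 :+ (con 1 :+ y)))
                            := ((con 1 :+ x) :+ q :* (con 1 :+ y)) :+ ((con 1 :+ x) :+ q :* (con 1 :+ y)))
                   refl (i × 1#) q (r × 1#) ⟩
      (suc i × 1# + q * (suc r × 1#)) + (suc i × 1# + q * (suc r × 1#))
        ≡⟨ cong (λ m → (suc i × 1# + q * (m × 1#)) + (suc i × 1# + q * (m × 1#))) (sym N∸1+i) ⟩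
      affine (suc i) + affine (suc i) ∎
      where
      r : ℕ
      r = N ∸ suc (suc i)
      N∸1+i : N ∸ suc i ≡ suc r
      N∸1+i = N∸i≡1+N∸1+i 1+i<N
      N∸i : N ∸ i ≡ suc (suc r)
      N∸i = trans (N∸i≡1+N∸1+i (ℕₚ.<-trans (ℕₚ.n<1+n i) 1+i<N)) (cong suc N∸1+i)

    weight-harmonic : ∀ {i} → suc i ℕ.< N →
                      forward (suc i) * weight (suc (suc i)) + backward i * weight i ≡ weight (suc i) + weight (suc i)
    weight-harmonic {i} 1+i<N = begin-equality
      forward j * weight (suc j) + backward i * weight i
        ≡⟨ solve 6 (λ f b g b′ a a′ → f :* ((g :* b′) :* b :* a) :+ b′ :* (g :* a′)
                                    := (f :* b) :* ((g :* b′) :* a) :+ (g :* b′) :* a′)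
                   refl (forward j) (backward j) (gauge i) (backward i) (affine (suc j)) (affine i) ⟩
      (forward j * backward j) * (gauge j * affine (suc j)) + gauge j * affine i
        ≡⟨ cong (λ t → t * (gauge j * affine (suc j)) + gauge j * affine i) (forward*backward≡1 1+i<N) ⟩
      1# * (gauge j * affine (suc j)) + gauge j * affine i
        ≡⟨ solve 3 (λ g a a′ → con 1 :* (g :* a) :+ g :* a′ := g :* (a :+ a′)) refl (gauge j) (affine (suc j)) (affine i) ⟩
      gauge j * (affine (suc j) + affine i)
        ≡⟨ cong (gauge j *_) (affine-harmonic 1+i<N) ⟩
      gauge j * (affine j + affine j)
        ≡⟨ distribˡ (gauge j) (affine j) (affine j) ⟩
      weight j + weight j ∎
      where
      j : ℕ
      j = suc i

    weight-N≡weight-0 : weight N ≡ weight 0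
    weight-N≡weight-0 = begin-equality
      q * (N × 1# + q * ((N ∸ N) × 1#))  ≡⟨ cong (λ m → q * (N × 1# + q * (m × 1#))) (ℕₚ.n∸n≡0 N) ⟩
      q * (N × 1# + q * 0#)              ≡⟨ solve 2 (λ q n → q :* (n :+ q :* con 0) := con 1 :* (con 0 :+ q :* n)) refl q (N × 1#) ⟩
      weight 0                           ∎

    weight-subharmonic-0 : weight 0 + weight 0 ≤ forward 0 * weight 1 + backward L * weight L
    weight-subharmonic-0 = begin
      weight 0 + weight 0
        ≡⟨ solve 2 (λ q ℓ → con 1 :* (con 0 :+ q :* (con 1 :+ ℓ)) :+ con 1 :* (con 0 :+ q :* (con 1 :+ ℓ))
                          := (q :+ q) :+ (q :* ℓ :+ q :* ℓ)) refl q ℓ ⟩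
      (q + q) + (q * ℓ + q * ℓ)
        ≤⟨ +-monoˡ-≤ (q * ℓ + q * ℓ) (x+x≤1+x*x q) ⟩
      (1# + q * q) + (q * ℓ + q * ℓ)
        ≡⟨ solve 2 (λ q ℓ → (con 1 :+ q :* q) :+ (q :* ℓ :+ q :* ℓ) := con 1 :* (con 1 :+ q :* ℓ) :+ q :* (ℓ :+ q))
                   refl q ℓ ⟩
      1# * (1# + q * ℓ) + q * (ℓ + q)
        ≡⟨ cong (λ t → t * (1# + q * ℓ) + q * (ℓ + q)) (sym (forward*backward≡1 (s≤s z≤n))) ⟩
      (forward 0 * backward 0) * (1# + q * ℓ) + q * (ℓ + q)
        ≡⟨ solve 6 (λ f b g b′ q ℓ → (f :* b) :* (con 1 :+ q :* ℓ) :+ (g :* b′) :* (ℓ :+ q)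
                                   := f :* ((con 1 :* b) :* ((con 1 :+ con 0) :+ q :* ℓ)) :+ b′ :* (g :* (ℓ :+ q :* (con 1 :+ con 0))))
                   refl (forward 0) (backward 0) (gauge L) (backward L) q ℓ ⟩
      forward 0 * weight 1 + backward L * (gauge L * (ℓ + q * (1 × 1#)))
        ≡⟨ cong (λ m → forward 0 * weight 1 + backward L * (gauge L * (ℓ + q * (m × 1#)))) (sym (ℕₚ.m+n∸n≡m 1 k)) ⟩
      forward 0 * weight 1 + backward L * weight L ∎
      where
      ℓ : Carrier
      ℓ = L × 1#

    c-node : ∀ {j} → j ℕ.≤ N → c (node j) ≡ weight j
    c-node j≤N with ℕₚ.m≤n⇒m<n∨m≡n j≤N
    ... | inj₁ j<N = cong weight (toℕ-node j<N)
    ... | inj₂ refl = trans (cong weight toℕ-node-N) (sym weight-N≡weight-0)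

    row-nonpos : ∀ {i j l} → CycSucc F N (node i) (node j) → CycSucc F N (node j) (node l) →
                 i ℕ.≤ N → j ℕ.≤ N → l ℕ.≤ N →
                 weight j + weight j ≤ - M (node j) (node l) * weight l + - M (node j) (node i) * weight i →
                 (M *ᵛ c) (node j) ≤ 0#
    row-nonpos {i} {j} {l} i↦j j↦l i≤N j≤N l≤N ineq = *ᵛ-row-nonpos i↦j j↦l c (begin
      c (node j) + c (node j)           ≡⟨ cong₂ _+_ (c-node j≤N) (c-node j≤N) ⟩
      weight j + weight j               ≤⟨ ineq ⟩
      - M (node j) (node l) * weight l + - M (node j) (node i) * weight i
        ≡⟨ sym (cong₂ (λ x y → - M (node j) (node l) * x + - M (node j) (node i) * y) (c-node l≤N) (c-node i≤N)) ⟩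
      - M (node j) (node l) * c (node l) + - M (node j) (node i) * c (node i) ∎)

    Mc≤0 : ∀ b → (M *ᵛ c) b ≤ 0#
    Mc≤0 b = subst (λ a → (M *ᵛ c) a ≤ 0#) (node-toℕ b) (row (toℕ<n b))
      where
      row : ∀ {j} → j ℕ.< N → (M *ᵛ c) (node j) ≤ 0#
      row {zero} _ = row-nonpos L↦0 (node-succ (s≤s z≤n)) (ℕₚ.n≤1+n L) z≤n (s≤s z≤n)
        (subst (λ a → weight 0 + weight 0 ≤ forward 0 * weight 1 + - M a (node L) * weight L) node-N weight-subharmonic-0)
        where
        L↦0 : CycSucc F N (node L) (node 0)
        L↦0 = subst (CycSucc F N (node L)) node-N (node-succ ℕₚ.≤-refl)
      row {suc i} 1+i<N = row-nonpos (node-succ (ℕₚ.<-trans (ℕₚ.n<1+n i) 1+i<N)) (node-succ 1+i<N)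
        (ℕₚ.<⇒≤ (ℕₚ.<-trans (ℕₚ.n<1+n i) 1+i<N)) (ℕₚ.<⇒≤ 1+i<N) 1+i<N (inj₂ (sym (weight-harmonic 1+i<N)))

  IsLoop⇒IsStandardUnitLoop : ∀ {M : Matrix F N} → IsEGCMBase F M → (loop : IsLoop F M) →
    (∀ i j → Edge F M i j → M i j * M j i ≡ 1#) → IsStandardUnitLoop (relabel (proj₁ loop) M)
  IsLoop⇒IsStandardUnitLoop {M} egcm (σ , σ-injective , loop) unit = record
    { diagonal          = diag ∘ σ
    ; support           = λ a b a≢b Mab≢0 → proj₁ (loop a b a≢b) (a≢b ∘ σ-injective , Mab≢0)
    ; adjacent-negative = λ a b a~b → ≤∧≢⇒< (offdiag _ _ (proj₁ (edge a~b))) (proj₂ (edge a~b))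
    ; adjacent-product  = λ a b a~b → unit _ _ (edge a~b)
    }
    where
    open IsEGCMBase egcm
    edge : ∀ {a b} → CycAdj F N a b → Edge F M (σ a) (σ b)
    edge {a} {b} a~b = proj₂ (loop a b (CycAdj-irrefl a~b)) a~b

lemma6p4 : (F : OrderedField) → (n : ℕ) → n ≥ 3 → (M : Matrix F n) →
    IsEGCMBase F M → IsLoop F M →
    (∀ i j → Edge F M i j → OrderedField._*_ F (M i j) (M j i) ≡ OrderedField.1# F) →
    ¬ Admissible F M
lemma6p4 F _ (s≤s (s≤s (s≤s {n = k} z≤n))) M egcm loop@(σ , σ-injective , _) unit =
  positive-Mc≤0⇒¬Admissible (relabel σ M) c c-positive Mc≤0 ∘ admissible-relabel σ-injective
  where
  open Potential F
  open Relabelling F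
  open StandardUnitLoop F k
  open UnitLoop (IsLoop⇒IsStandardUnitLoop egcm loop unit) using (c; c-positive; Mc≤0)
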